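{- Let $G=(V,E)$ be a $\Delta$-regular graph on $n$ vertices and let $S\subseteq V$ with $1\le |S|\le n/2$. If $S$ is locally optimal, then $d+d'\le\Delta+1$, and consequently $\min\{d,d'\}\le\lceil\Delta/2\rceil$.
   Context: For $S\subseteq V$, $c(S)$ is the number of edges with exactly one endpoint in $S$. The out-degree of a vertex (with respect to the partition $S, V\setminus S$) is the number of its neighbours on the other side of the partition. $d$ denotes the maximum out-degree of a vertex of $S$, and $d'$ the maximum out-degree of a vertex of $V\setminus S$. A set $S$ with $|S|\le n/2$ is locally improvable if there exist $u\in S$ and $v\in V\setminus S$ such that $c\big((S\setminus\{u\})\cup\{v\}\big)<c(S)$; otherwise $S$ is locally optimal. -}

module Defs where

open import Data.Nat using (ℕ; _+_; _⊔_; _<_)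
open import Data.Bool using (Bool; true; false; if_then_else_; _∧_; _xor_; not)
open import Data.Fin using (Fin)
open import Data.Nat.ListAction using (sum)
open import Data.List using (List; map; allFin; filterᵇ; foldr)
open import Data.Vec using (lookup; _[_]≔_)
open import Data.Fin.Subset using (Subset; inside; outside; _∈_; _∉_)
open import Data.Product using (∃₂; _×_)
open import Relation.Nullary using (¬_)
open import Relation.Binary.PropositionalEquality using (_≡_)

record Graph (n : ℕ) : Set where
  field
    adj      : Fin n → Fin n → Bool
    sym      : ∀ u v → adj u v ≡ adj v u
    loopless : ∀ v → adj v v ≡ false
open Graph public

sumFin : {n : ℕ} → (Fin n → ℕ) → ℕ
sumFin {n} f = sum (map f (allFin n))

count : {n : ℕ} → (Fin n → Bool) → ℕ
count f = sumFin (λ i → if f i then 1 else 0)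

degree : {n : ℕ} → Graph n → Fin n → ℕ
degree G v = count (adj G v)

Regular : {n : ℕ} → Graph n → ℕ → Set
Regular G Δ = ∀ v → degree G v ≡ Δ

outdeg : {n : ℕ} → Graph n → Subset n → Fin n → ℕ
outdeg G S v = count (λ w → adj G v w ∧ (lookup S v xor lookup S w))

-- c(S): number of edges with exactly one endpoint in S
-- (each such edge is counted exactly once, at its endpoint in S)
cut : {n : ℕ} → Graph n → Subset n → ℕ
cut G S = sumFin (λ u → if lookup S u then outdeg G S u else 0)

maxList : List ℕ → ℕ
maxList = foldr _⊔_ 0

dIn : {n : ℕ} → Graph n → Subset n → ℕ
dIn {n} G S = maxList (map (outdeg G S) (filterᵇ (lookup S) (allFin n)))

dOut : {n : ℕ} → Graph n → Subset n → ℕ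
dOut {n} G S = maxList (map (outdeg G S) (filterᵇ (λ v → not (lookup S v)) (allFin n)))

swap : {n : ℕ} → Subset n → Fin n → Fin n → Subset n
swap S u v = (S [ u ]≔ outside) [ v ]≔ inside

LocallyImprovable : {n : ℕ} → Graph n → Subset n → Set
LocallyImprovable G S = ∃₂ λ u v → u ∈ S × v ∉ S × cut G (swap S u v) < cut G S

LocallyOptimal : {n : ℕ} → Graph n → Subset n → Set
LocallyOptimal G S = ¬ LocallyImprovable G S

module Submission where

-- Write χ : Fin n → Bool for the characteristic function of S and out χ x
-- for the number of neighbours of x on the other side.  The argument is the
-- classical exchange computation.
--   * Flipping a single vertex x (toggle) changes the cut by deg x - 2 out χ x,
--     i.e.  cut χ' + 2 out χ x = cut χ + deg x.
--   * Moving u out of S and then v into S (swap-cut) therefore gives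
--       cut χ₂ + 2 (out u + out v) = cut χ + deg u + deg v + 2 [uv ∈ E],
--     the extra term coming from the edge uv, which changes side twice.
--   * In a Δ-regular graph, out u + out v > Δ + 1 thus makes the swap
--     strictly decrease the cut (improving-swap); so in a locally optimal S
--     every pair u ∈ S, v ∉ S has out u + out v ≤ Δ + 1.
--   * d and d' are maxima attained at some u ∈ S and v ∉ S (or are 0), which
--     gives d + d' ≤ Δ + 1; the bound on the minimum is arithmetic.

open import Defs hiding (sym)
open import Data.Nat using (ℕ; zero; suc; _+_; _*_; _≤_; _<_; _⊓_; z≤n; ⌊_/2⌋; ⌈_/2⌉)
open import Data.Nat.Properties
open import Data.Nat.Solver using (module +-*-Solver)
open import Data.Bool using (Bool; true; false; not; _∧_; _xor_; if_then_else_; T?)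
open import Data.Bool.Properties
  using (∧-comm; ∧-zeroʳ; ∧-identityʳ; not-involutive; not-distribˡ-xor; not-distribʳ-xor;
         xor-same; xor-inverseˡ; T-≡)
open import Data.Fin using (Fin; punchIn)
import Data.Fin as F
open import Data.Fin.Properties using (punchInᵢ≢i)
open import Data.Fin.Subset using (Subset; ∣_∣; outside)
open import Data.Vec using (Vec; lookup; _[_]≔_)
open import Data.Vec.Properties using (lookup∘updateAt; lookup∘updateAt′; lookup⇒[]=; []=⇒lookup)
open import Data.List using (List; map; allFin; filterᵇ; tabulate)
import Data.Nat.ListAction as List
open import Data.List.Properties using (map-tabulate)
open import Data.List.Membership.Propositional.Properties using (foldr-selective; ∈-map⁻; ∈-filter⁻)
open import Data.Product using (_×_; _,_; ∃; proj₂)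
open import Data.Sum using (_⊎_; inj₁; inj₂)
open import Function using (_∘_; id)
open import Function.Bundles using (Equivalence)
open import Relation.Nullary using (yes; no)
open import Relation.Binary.PropositionalEquality
open import Algebra.Properties.CommutativeMonoid.Sum +-0-commutativeMonoid
  using (∑-distrib-+; sum-cong-≗; sum-remove) renaming (sum to ∑)

open +-*-Solver using (solve; _:=_; _:+_; _:*_; con)

sumFin≡∑ : ∀ {n} (f : Fin n → ℕ) → sumFin f ≡ ∑ f
sumFin≡∑ f = trans (cong List.sum (map-tabulate id f)) (sum-tabulate f)
  where
  sum-tabulate : ∀ {m} (g : Fin m → ℕ) → List.sum (tabulate g) ≡ ∑ g
  sum-tabulate {zero}  g = refl
  sum-tabulate {suc m} g = cong (g F.zero +_) (sum-tabulate (g ∘ F.suc))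

∑-mono : ∀ {n} {f g : Fin n → ℕ} → (∀ i → f i ≤ g i) → ∑ f ≤ ∑ g
∑-mono {zero}  _   = z≤n
∑-mono {suc n} f≤g = +-mono-≤ (f≤g F.zero) (∑-mono (f≤g ∘ F.suc))

-- Changing one summand: if f and g agree away from x, then
-- ∑ f - f x = ∑ g - g x, stated without subtraction.
∑-update : ∀ {n} (f g : Fin n → ℕ) (x : Fin n) →
           (∀ y → y ≢ x → f y ≡ g y) → ∑ f + g x ≡ ∑ g + f x
∑-update {zero}  _ _ () _
∑-update {suc n} f g x agree = begin
  ∑ f + g x                          ≡⟨ cong (_+ g x) (sum-remove {i = x} f) ⟩
  (f x + ∑ (f ∘ punchIn x)) + g x    ≡⟨ cong (λ r → (f x + r) + g x) rest ⟩
  (f x + ∑ (g ∘ punchIn x)) + g x    ≡⟨ solve 3 (λ a b r → (a :+ r) :+ b := (b :+ r) :+ a) refl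
                                              (f x) (g x) (∑ (g ∘ punchIn x)) ⟩
  (g x + ∑ (g ∘ punchIn x)) + f x    ≡⟨ cong (_+ f x) (sym (sum-remove {i = x} g)) ⟩
  ∑ g + f x                          ∎
  where
  open ≡-Reasoning
  rest : ∑ (f ∘ punchIn x) ≡ ∑ (g ∘ punchIn x)
  rest = sum-cong-≗ (λ j → agree (punchIn x j) (punchInᵢ≢i x j))

⟦_⟧ : Bool → ℕ
⟦ b ⟧ = if b then 1 else 0

#_ : ∀ {n} → (Fin n → Bool) → ℕ
# p = ∑ (λ i → ⟦ p i ⟧)

⟦⟧≤1 : ∀ b → ⟦ b ⟧ ≤ 1
⟦⟧≤1 true  = ≤-refl
⟦⟧≤1 false = z≤n

⟦∧⟧≤ : ∀ a b → ⟦ a ∧ b ⟧ ≤ ⟦ a ⟧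
⟦∧⟧≤ true  b = ⟦⟧≤1 b
⟦∧⟧≤ false b = z≤n

⟦∧false⟧ : ∀ a → ⟦ a ∧ false ⟧ ≡ 0
⟦∧false⟧ a = cong ⟦_⟧ (∧-zeroʳ a)

⟦∧true⟧ : ∀ a → ⟦ a ∧ true ⟧ ≡ ⟦ a ⟧
⟦∧true⟧ a = cong ⟦_⟧ (∧-identityʳ a)

#-split : ∀ {n} (p q : Fin n → Bool) →
          # (λ i → p i ∧ q i) + # (λ i → p i ∧ not (q i)) ≡ # p
#-split p q = trans (sym (∑-distrib-+ (λ i → ⟦ p i ∧ q i ⟧) (λ i → ⟦ p i ∧ not (q i) ⟧)))
                    (sum-cong-≗ (λ i → split (p i) (q i)))
  where
  split : ∀ a b → ⟦ a ∧ b ⟧ + ⟦ a ∧ not b ⟧ ≡ ⟦ a ⟧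
  split true  true  = refl
  split true  false = refl
  split false b     = refl

record Flip {n : ℕ} (χ : Fin n → Bool) (x : Fin n) (χ' : Fin n → Bool) : Set where
  field
    at  : χ' x ≡ not (χ x)
    off : ∀ y → y ≢ x → χ' y ≡ χ y
open Flip

flip-sym : ∀ {n} {χ χ' : Fin n → Bool} {x : Fin n} → Flip χ x χ' → Flip χ' x χ
flip-sym {χ = χ} {x = x} fl = record
  { at  = trans (sym (not-involutive (χ x))) (cong not (sym (at fl)))
  ; off = λ y y≢x → sym (off fl y y≢x)
  }

update-flips : ∀ {n} (S : Vec Bool n) (x : Fin n) {b : Bool} →
               b ≡ not (lookup S x) → Flip (lookup S) x (lookup (S [ x ]≔ b))
update-flips S x b≡ = record
  { at  = trans (lookup∘updateAt x S) b≡
  ; off = λ y y≢x → lookup∘updateAt′ y x y≢x S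
  }

separated : ∀ {n} {χ : Fin n → Bool} {u v : Fin n} → χ u ≡ true → χ v ≡ false → v ≢ u
separated χu χv refl with trans (sym χu) χv
... | ()

module Cut {n : ℕ} (G : Graph n) where

  deg : Fin n → ℕ
  deg x = # adj G x

  out : (Fin n → Bool) → Fin n → ℕ
  out χ x = # (λ w → adj G x w ∧ (χ x xor χ w))

  row : (Fin n → Bool) → Fin n → ℕ
  row χ u = if χ u then out χ u else 0

  cutᶜ : (Fin n → Bool) → ℕ
  cutᶜ χ = ∑ (row χ)

  degree≡deg : ∀ v → degree G v ≡ deg v
  degree≡deg v = sumFin≡∑ (λ w → ⟦ adj G v w ⟧)

  outdeg≡out : ∀ S v → outdeg G S v ≡ out (lookup S) v
  outdeg≡out S v = sumFin≡∑ (λ w → ⟦ adj G v w ∧ (lookup S v xor lookup S w) ⟧)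

  cut≡cutᶜ : ∀ S → cut G S ≡ cutᶜ (lookup S)
  cut≡cutᶜ S = trans (sumFin≡∑ (λ u → if lookup S u then outdeg G S u else 0))
    (sum-cong-≗ (λ u → cong (λ m → if lookup S u then m else 0) (outdeg≡out S u)))

  out≤deg : ∀ χ x → out χ x ≤ deg x
  out≤deg χ x = ∑-mono (λ w → ⟦∧⟧≤ (adj G x w) _)

  -- After flipping x, its neighbours on the other side are exactly those
  -- that were on its side; x has no loop, so its own flip does not matter.
  out-flip-self : ∀ {χ χ' x} → Flip χ x χ' → out χ x + out χ' x ≡ deg x
  out-flip-self {χ} {χ'} {x} fl =
    trans (cong (out χ x +_) (sum-cong-≗ other-side)) (#-split (adj G x) (λ w → χ x xor χ w))
    where
    other-side : ∀ w → ⟦ adj G x w ∧ (χ' x xor χ' w) ⟧ ≡ ⟦ adj G x w ∧ not (χ x xor χ w) ⟧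
    other-side w with w F.≟ x
    ... | yes refl rewrite loopless G w = refl
    ... | no w≢x = cong (λ b → ⟦ adj G x w ∧ b ⟧)
        (trans (cong₂ _xor_ (at fl) (off fl w w≢x)) (sym (not-distribˡ-xor (χ x) (χ w))))

  -- For y ≠ x, flipping x only changes the status of the edge yx.
  out-flip-other : ∀ {χ χ' x y} → Flip χ x χ' → y ≢ x →
    out χ' y + ⟦ adj G y x ∧ (χ y xor χ x) ⟧ ≡ out χ y + ⟦ adj G y x ∧ not (χ y xor χ x) ⟧
  out-flip-other {χ} {χ'} {x} {y} fl y≢x =
    trans (∑-update summand' summand x agree) (cong (out χ y +_) flipped-edge)
    where
    summand summand' : Fin n → ℕ
    summand  w = ⟦ adj G y w ∧ (χ y xor χ w) ⟧
    summand' w = ⟦ adj G y w ∧ (χ' y xor χ' w) ⟧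
    agree : ∀ w → w ≢ x → summand' w ≡ summand w
    agree w w≢x = cong (λ b → ⟦ adj G y w ∧ b ⟧) (cong₂ _xor_ (off fl y y≢x) (off fl w w≢x))
    flipped-edge : summand' x ≡ ⟦ adj G y x ∧ not (χ y xor χ x) ⟧
    flipped-edge = cong (λ b → ⟦ adj G y x ∧ b ⟧)
      (trans (cong₂ _xor_ (off fl y y≢x) (at fl)) (sym (not-distribʳ-xor (χ y) (χ x))))

  out-flip-same-side : ∀ {χ χ' x y} → Flip χ x χ' → y ≢ x → χ y ≡ χ x →
                       out χ' y ≡ out χ y + ⟦ adj G y x ⟧
  out-flip-same-side {χ} {χ'} {x} {y} fl y≢x same = begin
    out χ' y                              ≡⟨ sym (+-identityʳ _) ⟩
    out χ' y + 0                          ≡⟨ cong (out χ' y +_) (sym (⟦∧false⟧ a)) ⟩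
    out χ' y + ⟦ a ∧ false ⟧              ≡⟨ cong (λ b → out χ' y + ⟦ a ∧ b ⟧) (sym s≡false) ⟩
    out χ' y + ⟦ a ∧ (χ y xor χ x) ⟧      ≡⟨ out-flip-other fl y≢x ⟩
    out χ y + ⟦ a ∧ not (χ y xor χ x) ⟧   ≡⟨ cong (λ b → out χ y + ⟦ a ∧ not b ⟧) s≡false ⟩
    out χ y + ⟦ a ∧ true ⟧                ≡⟨ cong (out χ y +_) (⟦∧true⟧ a) ⟩
    out χ y + ⟦ a ⟧                       ∎
    where
    open ≡-Reasoning
    a = adj G y x
    s≡false : χ y xor χ x ≡ false
    s≡false = trans (cong (_xor χ x) same) (xor-same (χ x))

  out-flip-other-side : ∀ {χ χ' x y} → Flip χ x χ' → y ≢ x → χ y ≡ not (χ x) →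
                        out χ' y + ⟦ adj G y x ⟧ ≡ out χ y
  out-flip-other-side {χ} {χ'} {x} {y} fl y≢x opposite = begin
    out χ' y + ⟦ a ⟧                      ≡⟨ cong (out χ' y +_) (sym (⟦∧true⟧ a)) ⟩
    out χ' y + ⟦ a ∧ true ⟧               ≡⟨ cong (λ b → out χ' y + ⟦ a ∧ b ⟧) (sym s≡true) ⟩
    out χ' y + ⟦ a ∧ (χ y xor χ x) ⟧      ≡⟨ out-flip-other fl y≢x ⟩
    out χ y + ⟦ a ∧ not (χ y xor χ x) ⟧   ≡⟨ cong (λ b → out χ y + ⟦ a ∧ not b ⟧) s≡true ⟩
    out χ y + ⟦ a ∧ false ⟧               ≡⟨ cong (out χ y +_) (⟦∧false⟧ a) ⟩
    out χ y + 0                           ≡⟨ +-identityʳ _ ⟩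
    out χ y                               ∎
    where
    open ≡-Reasoning
    a = adj G y x
    s≡true : χ y xor χ x ≡ true
    s≡true = trans (cong (_xor χ x) opposite) (xor-inverseˡ (χ x))

  -- Moving x off the true side: its out-edges leave the cut, and the edges
  -- to its former side (deg x - out χ x of them) enter it.
  toggle-in : ∀ {χ χ' x} → Flip χ x χ' → χ x ≡ true →
              cutᶜ χ' + (out χ x + out χ x) ≡ cutᶜ χ + deg x
  toggle-in {χ} {χ'} {x} fl χx = begin
    cutᶜ χ' + (o + o)        ≡⟨ sym (+-assoc (cutᶜ χ') o o) ⟩
    (cutᶜ χ' + o) + o        ≡⟨ cong (_+ o) rows ⟩
    (cutᶜ χ + same-side) + o ≡⟨ +-assoc (cutᶜ χ) same-side o ⟩
    cutᶜ χ + (same-side + o) ≡⟨ cong (cutᶜ χ +_) neighbours ⟩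
    cutᶜ χ + deg x           ∎
    where
    open ≡-Reasoning
    o = out χ x
    same-side : ℕ
    same-side = # (λ y → χ y ∧ adj G y x)
    g : Fin n → ℕ
    g y = row χ y + ⟦ χ y ∧ adj G y x ⟧
    row-off : ∀ y → y ≢ x → row χ' y ≡ g y
    row-off y y≢x = trans (cong (λ b → if b then out χ' y else 0) (off fl y y≢x))
                          (by-side (χ y) refl)
      where
      by-side : ∀ b → χ y ≡ b →
                (if b then out χ' y else 0) ≡ (if b then out χ y else 0) + ⟦ b ∧ adj G y x ⟧
      by-side false _  = refl
      by-side true  χy = out-flip-same-side fl y≢x (trans χy (sym χx))
    g-at-x : g x ≡ o
    g-at-x = trans (cong₂ _+_ (cong (λ b → if b then o else 0) χx)
                              (trans (cong (λ b → ⟦ b ∧ adj G x x ⟧) χx) (cong ⟦_⟧ (loopless G x))))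
                   (+-identityʳ o)
    row'-at-x : row χ' x ≡ 0
    row'-at-x = cong (λ b → if b then out χ' x else 0) (trans (at fl) (cong not χx))
    rows : cutᶜ χ' + o ≡ cutᶜ χ + same-side
    rows = begin
      cutᶜ χ' + o         ≡⟨ cong (cutᶜ χ' +_) (sym g-at-x) ⟩
      cutᶜ χ' + g x       ≡⟨ ∑-update (row χ') g x row-off ⟩
      ∑ g + row χ' x      ≡⟨ trans (cong (∑ g +_) row'-at-x) (+-identityʳ (∑ g)) ⟩
      ∑ g                 ≡⟨ ∑-distrib-+ (row χ) _ ⟩
      cutᶜ χ + same-side  ∎
    same-side-sym : same-side ≡ # (λ w → adj G x w ∧ χ w)
    same-side-sym = sum-cong-≗ (λ y →
      cong ⟦_⟧ (trans (∧-comm (χ y) (adj G y x)) (cong (_∧ χ y) (Graph.sym G y x))))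
    out-x : o ≡ # (λ w → adj G x w ∧ not (χ w))
    out-x = sum-cong-≗ (λ w → cong (λ b → ⟦ adj G x w ∧ (b xor χ w) ⟧) χx)
    neighbours : same-side + o ≡ deg x
    neighbours = trans (cong₂ _+_ same-side-sym out-x) (#-split (adj G x) χ)

  -- Flipping any vertex x changes the cut by deg x - 2 out χ x.  The case
  -- χ x ≡ false is the previous one read backwards, using out-flip-self.
  toggle : ∀ {χ χ' x} → Flip χ x χ' → cutᶜ χ' + (out χ x + out χ x) ≡ cutᶜ χ + deg x
  toggle {χ} {χ'} {x} fl = by-side (χ x) refl
    where
    open ≡-Reasoning
    o  = out χ x
    o' = out χ' x
    by-side : ∀ b → χ x ≡ b → cutᶜ χ' + (o + o) ≡ cutᶜ χ + deg x
    by-side true  χx = toggle-in fl χx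
    by-side false χx = +-cancelʳ-≡ (o' + o') _ _ (begin
      (cutᶜ χ' + (o + o)) + (o' + o')  ≡⟨ solve 3 (λ c o o' → (c :+ (o :+ o)) :+ (o' :+ o')
                                                    := c :+ ((o :+ o') :+ (o :+ o'))) refl (cutᶜ χ') o o' ⟩
      cutᶜ χ' + ((o + o') + (o + o'))  ≡⟨ cong (λ d → cutᶜ χ' + (d + d)) (out-flip-self fl) ⟩
      cutᶜ χ' + (deg x + deg x)        ≡⟨ sym (+-assoc (cutᶜ χ') (deg x) (deg x)) ⟩
      (cutᶜ χ' + deg x) + deg x        ≡⟨ cong (_+ deg x) (sym back) ⟩
      (cutᶜ χ + (o' + o')) + deg x     ≡⟨ solve 3 (λ c s d → (c :+ s) :+ d := (c :+ d) :+ s)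
                                                refl (cutᶜ χ) (o' + o') (deg x) ⟩
      (cutᶜ χ + deg x) + (o' + o')     ∎)
      where
      back : cutᶜ χ + (o' + o') ≡ cutᶜ χ' + deg x
      back = toggle-in (flip-sym fl) (trans (at fl) (cong not χx))

  swap-cut : ∀ {χ χ₁ χ₂ u v} → Flip χ u χ₁ → Flip χ₁ v χ₂ → χ u ≡ true → χ v ≡ false →
             cutᶜ χ₂ + 2 * (out χ u + out χ v) ≡ cutᶜ χ + deg u + deg v + 2 * ⟦ adj G v u ⟧
  swap-cut {χ} {χ₁} {χ₂} {u} {v} fl₁ fl₂ χu χv = begin
    c₂ + 2 * (a + out χ v)          ≡⟨ cong (λ z → c₂ + 2 * (a + z)) (sym edge-uv) ⟩
    c₂ + 2 * (a + (b + t))          ≡⟨ solve 4 (λ c₂ a b t → c₂ :+ con 2 :* (a :+ (b :+ t))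
                                        := (c₂ :+ (b :+ b)) :+ (a :+ a) :+ con 2 :* t) refl c₂ a b t ⟩
    (c₂ + (b + b)) + (a + a) + 2 * t ≡⟨ cong (λ z → z + (a + a) + 2 * t) (toggle fl₂) ⟩
    (c₁ + deg v) + (a + a) + 2 * t  ≡⟨ solve 4 (λ c₁ d a t → (c₁ :+ d) :+ (a :+ a) :+ con 2 :* t
                                        := (c₁ :+ (a :+ a)) :+ d :+ con 2 :* t) refl c₁ (deg v) a t ⟩
    (c₁ + (a + a)) + deg v + 2 * t  ≡⟨ cong (λ z → z + deg v + 2 * t) (toggle fl₁) ⟩
    cutᶜ χ + deg u + deg v + 2 * t  ∎
    where
    open ≡-Reasoning
    c₁ = cutᶜ χ₁
    c₂ = cutᶜ χ₂
    a  = out χ u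
    b  = out χ₁ v
    t  = ⟦ adj G v u ⟧
    edge-uv : b + t ≡ out χ v
    edge-uv = out-flip-other-side fl₁ (separated χu χv) (trans χv (cong not (sym χu)))

-- The exchange strictly decreases the cut once 2 (out u + out v) exceeds
-- 2Δ plus the at most 2 contributed by the edge uv.
cut-decreases : ∀ {c c₂ D s t} → c₂ + 2 * s ≡ c + D + D + 2 * t → t ≤ 1 → D + 1 < s → c₂ < c
cut-decreases {c} {c₂} {D} {s} {t} swap-eq t≤1 big =
  ≤-trans (n≤1+n _) (+-cancelʳ-≤ (2 * D + 2) _ _ (begin
  (2 + c₂) + (2 * D + 2)  ≡⟨ solve 2 (λ c₂ D → (con 2 :+ c₂) :+ (con 2 :* D :+ con 2)
                                 := c₂ :+ con 2 :* (D :+ con 2)) refl c₂ D ⟩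
  c₂ + 2 * (D + 2)        ≤⟨ +-monoʳ-≤ c₂ (*-monoʳ-≤ 2 (subst (_≤ s) (sym (+-suc D 1)) big)) ⟩
  c₂ + 2 * s              ≡⟨ swap-eq ⟩
  c + D + D + 2 * t       ≤⟨ +-monoʳ-≤ (c + D + D) (*-monoʳ-≤ 2 t≤1) ⟩
  c + D + D + 2 * 1       ≡⟨ solve 2 (λ c D → c :+ D :+ D :+ con 2 :* con 1
                                 := c :+ (con 2 :* D :+ con 2)) refl c D ⟩
  c + (2 * D + 2)         ∎))
  where open ≤-Reasoning

improving-swap : ∀ {n Δ} (G : Graph n) → Regular G Δ → (S : Subset n) {u v : Fin n} →
                 lookup S u ≡ true → lookup S v ≡ false →
                 Δ + 1 < outdeg G S u + outdeg G S v → LocallyImprovable G S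
improving-swap {Δ = Δ} G regular S {u} {v} u∈S v∉S big =
  u , v , lookup⇒[]= u S u∈S , (λ v∈S → separated {χ = lookup S} ([]=⇒lookup v∈S) v∉S refl) ,
  subst₂ _<_ (sym (cut≡cutᶜ (swap S u v))) (sym (cut≡cutᶜ S))
    (cut-decreases swap-eq (⟦⟧≤1 (adj G v u))
      (subst (Δ + 1 <_) (cong₂ _+_ (outdeg≡out S u) (outdeg≡out S v)) big))
  where
  open Cut G
  S₁ = S [ u ]≔ outside
  fl₁ : Flip (lookup S) u (lookup S₁)
  fl₁ = update-flips S u (cong not (sym u∈S))
  fl₂ : Flip (lookup S₁) v (lookup (swap S u v))
  fl₂ = update-flips S₁ v (cong not (sym (trans (off fl₁ v (separated u∈S v∉S)) v∉S)))
  deg≡Δ : ∀ x → deg x ≡ Δ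
  deg≡Δ x = trans (sym (degree≡deg x)) (regular x)
  swap-eq : cutᶜ (lookup (swap S u v)) + 2 * (out (lookup S) u + out (lookup S) v)
            ≡ cutᶜ (lookup S) + Δ + Δ + 2 * ⟦ adj G v u ⟧
  swap-eq = subst₂ (λ du dv → _ ≡ cutᶜ (lookup S) + du + dv + _) (deg≡Δ u) (deg≡Δ v)
                   (swap-cut fl₁ fl₂ u∈S v∉S)

optimal-pair-bound : ∀ {n Δ} (G : Graph n) → Regular G Δ → (S : Subset n) →
                     LocallyOptimal G S → {u v : Fin n} → lookup S u ≡ true → lookup S v ≡ false →
                     outdeg G S u + outdeg G S v ≤ Δ + 1
optimal-pair-bound G regular S optimal u∈S v∉S =
  ≮⇒≥ (λ big → optimal (improving-swap G regular S u∈S v∉S big))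

ZeroOrAttained : ∀ {A : Set} → (A → Bool) → (A → ℕ) → ℕ → Set
ZeroOrAttained p f m = m ≡ 0 ⊎ ∃ λ x → p x ≡ true × m ≡ f x

maxList-attained : ∀ {A : Set} (f : A → ℕ) (p : A → Bool) (xs : List A) →
                   ZeroOrAttained p f (maxList (map f (filterᵇ p xs)))
maxList-attained f p xs with foldr-selective ⊔-sel 0 (map f (filterᵇ p xs))
... | inj₁ max≡0 = inj₁ max≡0
... | inj₂ max∈ with ∈-map⁻ f max∈
...   | x , x∈ , max≡fx =
  inj₂ (x , Equivalence.to T-≡ (proj₂ (∈-filter⁻ (T? ∘ p) {xs = xs} x∈)) , max≡fx)

-- d + d' ≤ Δ + 1 for a locally optimal S in a Δ-regular graph: when both
-- maxima are attained this is optimal-pair-bound, otherwise one of them is 0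
-- and the other is at most Δ.
out-degree-bound : ∀ {n Δ} (G : Graph n) → Regular G Δ → (S : Subset n) →
                   LocallyOptimal G S → dIn G S + dOut G S ≤ Δ + 1
out-degree-bound {n} {Δ} G regular S optimal =
  bound (maxList-attained (outdeg G S) (lookup S) (allFin n))
        (maxList-attained (outdeg G S) (not ∘ lookup S) (allFin n))
  where
  open Cut G
  outdeg≤Δ : ∀ x → outdeg G S x ≤ Δ
  outdeg≤Δ x = subst₂ _≤_ (sym (outdeg≡out S x)) (trans (sym (degree≡deg x)) (regular x))
                      (out≤deg (lookup S) x)
  at-most-Δ : ∀ {p m} → ZeroOrAttained p (outdeg G S) m → m ≤ Δ
  at-most-Δ (inj₁ refl)           = z≤n
  at-most-Δ (inj₂ (x , _ , refl)) = outdeg≤Δ x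
  bound : ∀ {d d'} → ZeroOrAttained (lookup S) (outdeg G S) d →
          ZeroOrAttained (not ∘ lookup S) (outdeg G S) d' → d + d' ≤ Δ + 1
  bound (inj₁ refl) d'-max = m≤n⇒m≤n+o 1 (at-most-Δ d'-max)
  bound {d} (inj₂ d-max) (inj₁ refl) =
    subst (_≤ Δ + 1) (sym (+-identityʳ d)) (m≤n⇒m≤n+o 1 (at-most-Δ (inj₂ d-max)))
  bound (inj₂ (u , u∈S , refl)) (inj₂ (v , v∉S , refl)) =
    optimal-pair-bound G regular S optimal u∈S (trans (sym (not-involutive _)) (cong not v∉S))

min≤⌈/2⌉ : ∀ {a b k} → a + b ≤ k + 1 → a ⊓ b ≤ ⌈ k /2⌉
min≤⌈/2⌉ {a} {b} {k} a+b≤ = begin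
  a ⊓ b                       ≡⟨ n≡⌊n+n/2⌋ (a ⊓ b) ⟩
  ⌊ a ⊓ b + a ⊓ b /2⌋         ≤⟨ ⌊n/2⌋-mono (≤-trans (+-mono-≤ (m⊓n≤m a b) (m⊓n≤n a b))
                                              (≤-trans a+b≤ (≤-reflexive (+-comm k 1)))) ⟩
  ⌈ k /2⌉                     ∎
  where open ≤-Reasoning

lemma4 : (n Δ : ℕ) (G : Graph n) → Regular G Δ →
         (S : Subset n) → 1 ≤ ∣ S ∣ → 2 * ∣ S ∣ ≤ n →
         LocallyOptimal G S →
         (dIn G S + dOut G S ≤ Δ + 1) × (dIn G S ⊓ dOut G S ≤ ⌈ Δ /2⌉)
lemma4 n Δ G regular S _ _ optimal = d+d'≤ , min≤⌈/2⌉ d+d'≤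
  where
  d+d'≤ : dIn G S + dOut G S ≤ Δ + 1
  d+d'≤ = out-degree-bound G regular S optimal
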